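{- Let $\ell\ge0$, and let $M$ be a finite, homogeneous, almost safe lambda-term of complexity $\ell+1$ and order at most $\ell$, all of whose free variables have order at most $\ell-1$. Then $M$ has a subterm of the form $(\lambda x.K)\,L$ where $L$ is closed, has order $\ell$, and no variable of order at least $\ell$ occurs in $L$ (neither free nor bound).
   Context: Sorts are built from $\mathsf{o}$ by $\to$; $\mathit{ord}(\mathsf{o})=0$, $\mathit{ord}(\alpha\to\beta)=\max(1+\mathit{ord}(\alpha),\mathit{ord}(\beta))$; the order of a term or variable is that of its sort. Lambda-terms are simply-typed lambda-terms over a signature of constants whose sorts have order at most $1$ (e.g. $\mathsf{a}_1,\dots,\mathsf{a}_s:\mathsf{o}\to\mathsf{o}$, $\mathsf{b}:\mathsf{o}\to\mathsf{o}\to\mathsf{o}$, $\mathsf{c},\omega:\mathsf{o}$). The complexity of $M$ is the maximum of the orders of those subterms of $M$ not of the form $a\,M_1\dots M_k$ with $a$ a constant and $k\ge0$ (or $0$ if none). A term $M$ is superficially safe if $\mathit{ord}(M)\le\mathit{ord}(x)$ for every free variable $x$ of $M$; it is almost safe if for every subterm $K\,L_1\dots L_k$ with $K$ not an application and $k\ge1$, all of $K,L_1,\dots,L_k$ are superficially safe. A sort $\alpha_1\to\dots\to\alpha_k\to\mathsf{o}$ is homogeneous if $\mathit{ord}(\alpha_1)\ge\dots\ge\mathit{ord}(\alpha_k)$ and each $\alpha_i$ is homogeneous; a term is homogeneous if every subterm has a homogeneous sort. -}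

module Defs where

open import Data.Nat using (ℕ; zero; suc; _≤_; _<_; _⊔_)
open import Data.Bool using (Bool; true; false; if_then_else_)
open import Data.Product using (Σ; ∃; _×_; _,_; proj₁; proj₂)
open import Data.List using (List; []; _∷_; _++_; [_])
open import Data.List.Relation.Unary.All using (All)
open import Data.Unit using (⊤)
open import Relation.Binary.PropositionalEquality using (_≡_)
open import Relation.Nullary using (¬_)

infixr 5 _⇒_
data Sort : Set where
  o   : Sort
  _⇒_ : Sort → Sort → Sort

ord : Sort → ℕ
ord o       = 0
ord (α ⇒ β) = suc (ord α) ⊔ ord β

-- Homogeneous sorts: α₁ → … → αₖ → o is homogeneous iff
-- ord α₁ ≥ … ≥ ord αₖ and every αᵢ is homogeneous.
-- (Checked pairwise for consecutive arguments.)
FirstArgBelow : ℕ → Sort → Set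
FirstArgBelow n o       = ⊤
FirstArgBelow n (γ ⇒ δ) = ord γ ≤ n

HomSort : Sort → Set
HomSort o       = ⊤
HomSort (α ⇒ β) = HomSort α × HomSort β × FirstArgBelow (ord α) β

record Signature : Set₁ where
  field
    Const   : Set
    sortOf  : Const → Sort
    ord≤1   : ∀ c → ord (sortOf c) ≤ 1

Var : Set
Var = ℕ × Sort

sortV : Var → Sort
sortV = proj₂

ordV : Var → ℕ
ordV x = ord (sortV x)

module Lambda (Sg : Signature) where
  open Signature Sg

  data Term : Sort → Set where
    var : (x : Var) → Term (sortV x)
    con : (c : Const) → Term (sortOf c)
    app : ∀ {α β} → Term (α ⇒ β) → Term α → Term β
    lam : ∀ {β} (n : ℕ) (α : Sort) → Term β → Term (α ⇒ β)

  ATerm : Set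
  ATerm = Σ Sort Term

  ordT : ∀ {α} → Term α → ℕ
  ordT {α} _ = ord α

  infix 4 _⊑_
  data _⊑_ : ∀ {α β} → Term α → Term β → Set where
    here : ∀ {α} {M : Term α} → M ⊑ M
    appˡ : ∀ {α β γ} {S : Term γ} {M : Term (α ⇒ β)} {N : Term α} → S ⊑ M → S ⊑ app M N
    appʳ : ∀ {α β γ} {S : Term γ} {M : Term (α ⇒ β)} {N : Term α} → S ⊑ N → S ⊑ app M N
    lamᵇ : ∀ {α β γ n} {S : Term γ} {M : Term β} → S ⊑ M → S ⊑ lam n α M

  data FreeIn (x : Var) : ∀ {α} → Term α → Set where
    var  : FreeIn x (var x)
    appˡ : ∀ {α β} {M : Term (α ⇒ β)} {N : Term α} → FreeIn x M → FreeIn x (app M N)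
    appʳ : ∀ {α β} {M : Term (α ⇒ β)} {N : Term α} → FreeIn x N → FreeIn x (app M N)
    lamᵇ : ∀ {α β n} {M : Term β} → ¬ (x ≡ (n , α)) → FreeIn x M → FreeIn x (lam n α M)

  data OccursIn (x : Var) : ∀ {α} → Term α → Set where
    var  : OccursIn x (var x)
    appˡ : ∀ {α β} {M : Term (α ⇒ β)} {N : Term α} → OccursIn x M → OccursIn x (app M N)
    appʳ : ∀ {α β} {M : Term (α ⇒ β)} {N : Term α} → OccursIn x N → OccursIn x (app M N)
    lamᵇ : ∀ {α β n} {M : Term β} → OccursIn x M → OccursIn x (lam n α M)
    binder : ∀ {α β n} {M : Term β} → x ≡ (n , α) → OccursIn x (lam n α M)

  Closed : ∀ {α} → Term α → Set
  Closed M = ∀ x → ¬ FreeIn x M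

  constHeaded : ∀ {α} → Term α → Bool
  constHeaded (var x)     = false
  constHeaded (con c)     = true
  constHeaded (app M N)   = constHeaded M
  constHeaded (lam n α M) = false

  isApp : ∀ {α} → Term α → Bool
  isApp (app M N) = true
  isApp _         = false

  -- complexity: maximum of the orders of subterms not of the form
  -- a M₁ … Mₖ (a a constant), or 0 if there is none
  own : ∀ {α} → Term α → ℕ
  own {α} M = if constHeaded M then 0 else ord α

  complexity : ∀ {α} → Term α → ℕ
  complexity t@(var x)     = own t
  complexity t@(con c)     = own t
  complexity t@(app M N)   = own t ⊔ complexity M ⊔ complexity N
  complexity t@(lam n α M) = own t ⊔ complexity M

  SuperficiallySafe : ∀ {α} → Term α → Set
  SuperficiallySafe {α} M = ∀ x → FreeIn x M → ord α ≤ ordV x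

  SupSafe′ : ATerm → Set
  SupSafe′ (_ , M) = SuperficiallySafe M

  headOf : ∀ {α} → Term α → ATerm
  headOf (app M N) = headOf M
  headOf {α} t     = α , t

  argsOf : ∀ {α} → Term α → List ATerm
  argsOf (app {α} M N) = argsOf M ++ [ (α , N) ]
  argsOf _             = []

  AlmostSafe : ∀ {α} → Term α → Set
  AlmostSafe M = ∀ {β} (S : Term β) → S ⊑ M → isApp S ≡ true →
                 SupSafe′ (headOf S) × All SupSafe′ (argsOf S)

  Homogeneous : ∀ {α} → Term α → Set
  Homogeneous M = ∀ {β} (S : Term β) → S ⊑ M → HomSort β

-- Descend from M through subterms S with complexity ℓ + 1, own order ≤ ℓ and free variables of
-- order < ℓ. Since S itself has own order ≤ ℓ, the order ℓ + 1 is attained strictly inside; if not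
-- in an immediate subterm with the same invariant, then in the function P of an application P N
-- with ord N = ℓ. Along the application spine of P homogeneity keeps the first argument at order ℓ,
-- and the head can only be a λ-abstraction (a variable of order > ℓ cannot be free, a constant has
-- order ≤ 1). Its argument L is closed by almost safety. If complexity L ≤ ℓ every variable of L
-- has order < ℓ, since binders have order below the complexity; otherwise L satisfies the
-- invariant and the descent continues inside L.
module Submission where

open import Defs
open import Data.Nat using (ℕ; suc; _+_; _≤_; _<_; _⊔_; z≤n; s≤s; _≤?_)
open import Data.Nat.Properties
open import Data.Nat.Induction using (<-wellFounded)
open import Data.Bool using (true; false)
open import Data.Product using (Σ; _×_; _,_; proj₂)
open import Data.Product.Properties using (≡-dec)
open import Data.Sum using (_⊎_; inj₁; inj₂)
open import Data.Empty using (⊥; ⊥-elim)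
open import Data.List.Relation.Unary.All using (_∷_)
open import Function using (_∘_)
open import Induction.WellFounded using (Acc; acc)
open import Relation.Binary.Definitions using (DecidableEquality)
open import Relation.Nullary using (yes; no; ¬_; contradiction)
open import Relation.Binary.PropositionalEquality using (_≡_; refl; subst; sym; trans)

_≟ˢ_ : DecidableEquality Sort
o ≟ˢ o = yes refl
o ≟ˢ (_ ⇒ _) = no λ ()
(_ ⇒ _) ≟ˢ o = no λ ()
(α ⇒ β) ≟ˢ (γ ⇒ δ) with α ≟ˢ γ | β ≟ˢ δ
... | yes refl | yes refl = yes refl
... | no α≢γ | _ = no λ { refl → α≢γ refl }
... | yes _ | no β≢δ = no λ { refl → β≢δ refl }

_≟ᵛ_ : DecidableEquality Var
_≟ᵛ_ = ≡-dec _≟_ _≟ˢ_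

⊔≡-sel : ∀ {m n k} → m ⊔ n ≡ k → m ≡ k ⊎ n ≡ k
⊔≡-sel {m} {n} e with ⊔-sel m n
... | inj₁ m⊔n≡m = inj₁ (trans (sym m⊔n≡m) e)
... | inj₂ m⊔n≡n = inj₂ (trans (sym m⊔n≡n) e)

⊔≡suc⇒≡suc : ∀ {m n ℓ} → m ≤ ℓ → m ⊔ n ≡ suc ℓ → n ≡ suc ℓ
⊔≡suc⇒≡suc {m} {n} m≤ℓ e with ⊔≡-sel {m} {n} e
... | inj₁ refl = contradiction m≤ℓ 1+n≰n
... | inj₂ n≡1+ℓ = n≡1+ℓ

dom<ord : ∀ α β → ord α < ord (α ⇒ β)
dom<ord α β = m≤m⊔n (suc (ord α)) (ord β)

ord-dom≡ : ∀ {α β ℓ} → ord β ≤ ℓ → ord (α ⇒ β) ≤ suc ℓ → ¬ ord (α ⇒ β) ≤ ℓ → ord α ≡ ℓ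
ord-dom≡ {α} {β} β≤ℓ ≤1+ℓ ≰ℓ = ≤-antisym
  (≤-pred (≤-trans (dom<ord α β) ≤1+ℓ))
  (≮⇒≥ λ α<ℓ → ≰ℓ (⊔-lub α<ℓ β≤ℓ))

module _ (Sg : Signature) where
  open Signature Sg
  open Lambda Sg

  size : ∀ {σ} → Term σ → ℕ
  size (var x) = 1
  size (con c) = 1
  size (app P N) = suc (size P + size N)
  size (lam n α B) = suc (size B)

  ⊑-trans : ∀ {σ τ υ} {S : Term σ} {T : Term τ} {U : Term υ} → S ⊑ T → T ⊑ U → S ⊑ U
  ⊑-trans p here = p
  ⊑-trans p (appˡ q) = appˡ (⊑-trans p q)
  ⊑-trans p (appʳ q) = appʳ (⊑-trans p q)
  ⊑-trans p (lamᵇ q) = lamᵇ (⊑-trans p q)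

  size-mono : ∀ {σ τ} {S : Term σ} {T : Term τ} → S ⊑ T → size S ≤ size T
  size-mono here = ≤-refl
  size-mono (appˡ {M = P} {N} p) = ≤-trans (size-mono p) (m≤n⇒m≤1+n (m≤m+n (size P) (size N)))
  size-mono (appʳ {M = P} {N} p) = ≤-trans (size-mono p) (m≤n⇒m≤1+n (m≤n+m (size N) (size P)))
  size-mono (lamᵇ p) = m≤n⇒m≤1+n (size-mono p)

  own≤ord : ∀ {σ} (S : Term σ) → own S ≤ ord σ
  own≤ord S with constHeaded S
  ... | true = z≤n
  ... | false = ≤-refl

  own≡ord : ∀ {σ} (S : Term σ) → constHeaded S ≡ false → own S ≡ ord σ
  own≡ord S h rewrite h = refl

  own>⇒¬constHeaded : ∀ {σ m} (S : Term σ) → ¬ own S ≤ m → constHeaded S ≡ false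
  own>⇒¬constHeaded S own≰m with constHeaded S
  ... | true = contradiction z≤n own≰m
  ... | false = refl

  constHeaded⇒ord≤1 : ∀ {σ} (S : Term σ) → constHeaded S ≡ true → ord σ ≤ 1
  constHeaded⇒ord≤1 (con c) _ = ord≤1 c
  constHeaded⇒ord≤1 (app P N) h = m⊔n≤o⇒n≤o _ _ (constHeaded⇒ord≤1 P h)

  own≤complexity : ∀ {σ} (S : Term σ) → own S ≤ complexity S
  own≤complexity (var x) = ≤-refl
  own≤complexity (con c) = ≤-refl
  own≤complexity (app P N) = ≤-trans (m≤m⊔n _ _) (m≤m⊔n _ _)
  own≤complexity (lam n α B) = m≤m⊔n _ _

  complexity-mono : ∀ {σ τ} {S : Term σ} {T : Term τ} → S ⊑ T → complexity S ≤ complexity T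
  complexity-mono here = ≤-refl
  complexity-mono (appˡ {M = P} {N} p) =
    ≤-trans (complexity-mono p) (≤-trans (m≤n⊔m (own (app P N)) (complexity P)) (m≤m⊔n _ _))
  complexity-mono (appʳ p) = ≤-trans (complexity-mono p) (m≤n⊔m _ _)
  complexity-mono (lamᵇ p) = ≤-trans (complexity-mono p) (m≤n⊔m _ _)

  ord≤complexity : ∀ {σ} (S : Term σ) → constHeaded S ≡ false → ord σ ≤ complexity S
  ord≤complexity S h = subst (_≤ complexity S) (own≡ord S h) (own≤complexity S)

  own-argument≤ : ∀ {α β ℓ} (P : Term (α ⇒ β)) (N : Term α) →
             complexity (app P N) ≤ suc ℓ → own N ≤ ℓ
  own-argument≤ {α} {β} {ℓ} P N ≤1+ℓ = bound (≤-trans (complexity-mono (appˡ {S = P} {N = N} here)) ≤1+ℓ)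
    where
    bound : complexity P ≤ suc ℓ → own N ≤ ℓ
    bound P≤1+ℓ with constHeaded P in h
    ... | true = ≤-trans (own≤ord N)
                   (≤-trans (≤-pred (≤-trans (dom<ord α β) (constHeaded⇒ord≤1 P h))) z≤n)
    ... | false = ≤-pred (≤-trans (s≤s (own≤ord N))
                   (≤-trans (dom<ord α β) (≤-trans (ord≤complexity P h) P≤1+ℓ)))

  function-critical : ∀ {α β ℓ} (P : Term (α ⇒ β)) (N : Term α) → own (app P N) ≤ ℓ →
                      complexity P ≡ suc ℓ → ¬ own P ≤ ℓ → constHeaded P ≡ false × ord α ≡ ℓ
  function-critical {α} {β} P N P·N≤ℓ P≡ P≰ℓ = h , ord-dom≡ {α} {β}
    (subst (_≤ _) (own≡ord (app P N) h) P·N≤ℓ)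
    (subst (_≤ _) (own≡ord P h) (≤-trans (own≤complexity P) (≤-reflexive P≡)))
    (subst (λ k → ¬ k ≤ _) (own≡ord P h) P≰ℓ)
    where
    h : constHeaded P ≡ false
    h = own>⇒¬constHeaded P P≰ℓ

  occurs⇒free⊎<complexity : ∀ {x σ} {S : Term σ} →
                            OccursIn x S → FreeIn x S ⊎ ordV x < complexity S
  occurs⇒free⊎<complexity var = inj₁ var
  occurs⇒free⊎<complexity (appˡ {M = P} {N} p) with occurs⇒free⊎<complexity p
  ... | inj₁ f = inj₁ (appˡ f)
  ... | inj₂ x< = inj₂ (<-≤-trans x< (complexity-mono (appˡ {S = P} {N = N} here)))
  occurs⇒free⊎<complexity (appʳ {M = P} {N} p) with occurs⇒free⊎<complexity p
  ... | inj₁ f = inj₁ (appʳ f)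
  ... | inj₂ x< = inj₂ (<-≤-trans x< (complexity-mono (appʳ {S = N} {M = P} here)))
  occurs⇒free⊎<complexity {x} (lamᵇ {α} {β} {n} {B} p) with occurs⇒free⊎<complexity p | x ≟ᵛ (n , α)
  ... | inj₂ x< | _ = inj₂ (<-≤-trans x< (m≤n⊔m (ord (α ⇒ β)) (complexity B)))
  ... | inj₁ f | no x≢n = inj₁ (lamᵇ x≢n f)
  ... | inj₁ f | yes refl = inj₂ (<-≤-trans (dom<ord α β) (own≤complexity (lam n α B)))
  occurs⇒free⊎<complexity (binder {α} {β} {n} {B} refl) =
    inj₂ (<-≤-trans (dom<ord α β) (own≤complexity (lam n α B)))

  closed⇒occurs<complexity : ∀ {σ} {L : Term σ} →
                             Closed L → ∀ x → OccursIn x L → ordV x < complexity L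
  closed⇒occurs<complexity closed x occ with occurs⇒free⊎<complexity occ
  ... | inj₁ free = contradiction free (closed x)
  ... | inj₂ x<c = x<c

  FreeVarsBelow : ℕ → ∀ {σ} → Term σ → Set
  FreeVarsBelow ℓ S = ∀ x → FreeIn x S → ordV x < ℓ

  superficiallySafe⇒closed : ∀ {σ} {L : Term σ} →
                             SuperficiallySafe L → FreeVarsBelow (ord σ) L → Closed L
  superficiallySafe⇒closed safe below x free = <⇒≱ (below x free) (safe x free)

  homogeneous-⊑ : ∀ {σ τ} {T : Term τ} {S : Term σ} → T ⊑ S → Homogeneous S → Homogeneous T
  homogeneous-⊑ T⊑S hom U U⊑T = hom U (⊑-trans U⊑T T⊑S)

  almostSafe-⊑ : ∀ {σ τ} {T : Term τ} {S : Term σ} → T ⊑ S → AlmostSafe S → AlmostSafe T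
  almostSafe-⊑ T⊑S safe U U⊑T = safe U (⊑-trans U⊑T T⊑S)

  ClosedRedex : ℕ → ∀ {σ} → Term σ → Set
  ClosedRedex ℓ S = Σ ℕ λ n → Σ Sort λ β → Σ Sort λ γ → Σ (Term γ) λ K → Σ (Term β) λ L →
    app (lam n β K) L ⊑ S × Closed L × ord β ≡ ℓ × (∀ x → OccursIn x L → ordV x < ℓ)

  closedRedex-⊑ : ∀ {ℓ σ τ} {T : Term τ} {S : Term σ} → T ⊑ S → ClosedRedex ℓ T → ClosedRedex ℓ S
  closedRedex-⊑ T⊑S (n , β , γ , K , L , redex⊑T , rest) =
    n , β , γ , K , L , ⊑-trans redex⊑T T⊑S , rest

  -- The hypotheses of the theorem, with ord S ≤ ℓ weakened to own S ≤ ℓ: constant-headed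
  -- subterms (of order ≤ 1, possibly above ℓ = 0) must also be admitted for the descent.
  record Critical (ℓ : ℕ) {σ} (S : Term σ) : Set where
    constructor critical
    field
      homogeneous   : Homogeneous S
      almostSafe    : AlmostSafe S
      complexity≡   : complexity S ≡ suc ℓ
      own≤          : own S ≤ ℓ
      freeVarsBelow : FreeVarsBelow ℓ S

  CriticalBelow : ℕ → ∀ {σ} → Term σ → Set
  CriticalBelow ℓ S = Σ Sort λ τ → Σ (Term τ) λ T → T ⊑ S × size T < size S × Critical ℓ T

  module _ {ℓ σ} {S : Term σ} (crit : Critical ℓ S) where
    open Critical crit

    complexity≤ : ∀ {τ} {T : Term τ} → T ⊑ S → complexity T ≤ suc ℓ
    complexity≤ T⊑S = subst (_ ≤_) complexity≡ (complexity-mono T⊑S)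

    criticalBelow : ∀ {τ} {T : Term τ} → T ⊑ S → size T < size S →
                    complexity T ≡ suc ℓ → own T ≤ ℓ → FreeVarsBelow ℓ T → CriticalBelow ℓ S
    criticalBelow T⊑S T<S c≡ o≤ below = _ , _ , T⊑S , T<S , record
      { homogeneous = homogeneous-⊑ T⊑S homogeneous
      ; almostSafe = almostSafe-⊑ T⊑S almostSafe
      ; complexity≡ = c≡
      ; own≤ = o≤
      ; freeVarsBelow = below
      }

    -- Indexing by the sort of P lets matching on P reveal the sort of its argument.
    AppliedIn : ∀ {τ} → Term τ → Set
    AppliedIn {o} P = ⊥
    AppliedIn {α ⇒ β} P = Σ (Term α) λ N → app P N ⊑ S × ord α ≡ ℓ × FreeVarsBelow ℓ (app P N)

    closedArgument : ∀ {α β n} {K : Term β} {N : Term α} → app (lam n α K) N ⊑ S → ord α ≡ ℓ →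
                     Closed N → ClosedRedex ℓ S ⊎ CriticalBelow ℓ S
    closedArgument {α} {β} {n} {K} {N} q α≡ℓ closed with complexity N ≤? ℓ
    ... | yes N≤ℓ = inj₁ (n , α , β , K , N , q , closed , α≡ℓ ,
                          λ x occ → <-≤-trans (closed⇒occurs<complexity closed x occ) N≤ℓ)
    ... | no N≰ℓ = inj₂ (criticalBelow N⊑S (<-≤-trans (s≤s (m≤n+m _ _)) (size-mono q))
                     (≤-antisym (complexity≤ N⊑S) (≰⇒> N≰ℓ)) (subst (own N ≤_) α≡ℓ (own≤ord N))
                     λ x → ⊥-elim ∘ closed x)
      where
      N⊑S : N ⊑ S
      N⊑S = ⊑-trans (appʳ here) q

    headRedex : ∀ {τ} (P : Term τ) → constHeaded P ≡ false → AppliedIn P →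
                ClosedRedex ℓ S ⊎ CriticalBelow ℓ S
    headRedex (var (m , o)) _ ()
    headRedex (var (m , α ⇒ β)) _ (N , _ , α≡ℓ , below) =
      contradiction (below _ (appˡ var)) (<⇒≯ (subst (_< ord (α ⇒ β)) α≡ℓ (dom<ord α β)))
    headRedex (app {β = o} P N) _ ()
    headRedex (app {α′} {α ⇒ β} P N) h (N₀ , q , α≡ℓ , below) =
      headRedex P h (N , P·N⊑S , α′≡ℓ , λ x → below x ∘ appˡ)
      where
      P·N⊑S : app P N ⊑ S
      P·N⊑S = ⊑-trans (appˡ here) q
      P⊑S : P ⊑ S
      P⊑S = ⊑-trans (appˡ here) P·N⊑S
      α′≡ℓ : ord α′ ≡ ℓ
      α′≡ℓ = ≤-antisym
        (≤-pred (≤-trans (dom<ord α′ (α ⇒ β)) (≤-trans (ord≤complexity P h) (complexity≤ P⊑S))))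
        (subst (_≤ ord α′) α≡ℓ (proj₂ (proj₂ (homogeneous P P⊑S))))
    -- Almost safety makes the argument superficially safe, so a free variable of it would
    -- have order ≥ ℓ; the variables free in the application all have order < ℓ.
    headRedex (lam n α K) _ (N , q , α≡ℓ , below) with almostSafe (app (lam n α K) N) q refl
    ... | _ , safeN ∷ _ = closedArgument q α≡ℓ
      (superficiallySafe⇒closed safeN λ x → subst (ordV x <_) (sym α≡ℓ) ∘ below x ∘ appʳ)

  descend : ∀ {ℓ σ} (S : Term σ) → Critical ℓ S → ClosedRedex ℓ S ⊎ CriticalBelow ℓ S
  descend {ℓ} (var x) (critical _ _ c≡ o≤ _) = contradiction (subst (_≤ ℓ) c≡ o≤) 1+n≰n
  descend {ℓ} (con c) (critical _ _ c≡ o≤ _) = contradiction (subst (_≤ ℓ) c≡ o≤) 1+n≰n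
  descend {ℓ} (lam {β} n α B) crit@(critical _ _ c≡ o≤ below) = inj₂ (criticalBelow crit (lamᵇ here) ≤-refl
    (⊔≡suc⇒≡suc o≤ c≡) (≤-trans (own≤ord B) (≤-trans (m≤n⊔m _ _) o≤)) belowB)
    where
    belowB : FreeVarsBelow ℓ B
    belowB x free with x ≟ᵛ (n , α)
    ... | yes refl = <-≤-trans (dom<ord α β) o≤
    ... | no x≢n = below x (lamᵇ x≢n free)
  descend {ℓ} (app P N) crit@(critical _ _ c≡ o≤ below) with ⊔≡-sel {own (app P N) ⊔ complexity P} c≡
  ... | inj₂ N≡ = inj₂ (criticalBelow crit (appʳ here) (s≤s (m≤n+m _ _)) N≡
    (own-argument≤ P N (≤-reflexive c≡)) λ x → below x ∘ appʳ)
  ... | inj₁ e with ⊔≡suc⇒≡suc o≤ e | own P ≤? ℓ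
  ...   | P≡ | yes P≤ℓ = inj₂ (criticalBelow crit (appˡ here) (s≤s (m≤m+n _ _)) P≡ P≤ℓ
    λ x → below x ∘ appˡ)
  ...   | P≡ | no P≰ℓ with function-critical P N o≤ P≡ P≰ℓ
  ...     | h , α≡ℓ = headRedex crit P h (N , here , α≡ℓ , below)

  critical⇒closedRedex : ∀ {ℓ σ} (S : Term σ) → Critical ℓ S → ClosedRedex ℓ S
  critical⇒closedRedex S = go S (<-wellFounded (size S))
    where
    go : ∀ {ℓ σ} (S : Term σ) → Acc _<_ (size S) → Critical ℓ S → ClosedRedex ℓ S
    go S (acc rs) crit with descend S crit
    ... | inj₁ redex = redex
    ... | inj₂ (_ , T , T⊑S , T<S , critT) = closedRedex-⊑ T⊑S (go T (rs T<S) critT)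

lemma19 : (Sg : Signature) (ℓ : ℕ) {α : Sort} (M : Lambda.Term Sg α)
    → Lambda.Homogeneous Sg M
    → Lambda.AlmostSafe Sg M
    → Lambda.complexity Sg M ≡ suc ℓ
    → ord α ≤ ℓ
    → (∀ x → Lambda.FreeIn Sg x M → suc (ordV x) ≤ ℓ)
    → Σ ℕ λ n → Σ Sort λ β → Σ Sort λ γ → Σ (Lambda.Term Sg γ) λ K → Σ (Lambda.Term Sg β) λ L →
        (Lambda._⊑_ Sg (Lambda.app (Lambda.lam n β K) L) M)
        × Lambda.Closed Sg L
        × ord β ≡ ℓ
        × (∀ x → Lambda.OccursIn Sg x L → ordV x < ℓ)
lemma19 Sg ℓ M homogeneous almostSafe complexity≡ ordM≤ℓ freeVarsBelow =
  critical⇒closedRedex Sg M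
    (critical homogeneous almostSafe complexity≡ (≤-trans (own≤ord Sg M) ordM≤ℓ) freeVarsBelow)
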